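{- Let $R\ge1$ be odd and $n\ge R+1$. Choose a unicard initial state $a_1\,|\,a_2a_3\cdots a_n$ on $n$ cards uniformly at random and play War with WL-putback. The probability that the game is single-use and ends with Alice losing after exactly $R$ rounds is $\dfrac{C_{(R-1)/2}}{2^R}$, where $C_r=\frac1{r+1}\binom{2r}{r}$.
   Context: War with $n$ cards labelled $1,\dots,n$; the state $a_1\,|\,a_2\cdots a_n$ means Alice holds only $a_1$ and Bob holds $a_2,\dots,a_n$ from top to bottom (there are $n!$ such unicard states). In a round both reveal the top card and the owner of the higher card places both cards at the bottom of their hand, the winning card first and the losing card second (WL-putback). A player with no cards loses. Single-use: Alice loses before Bob plays any card he won. -}

module Defs where

open import Data.Nat using (ℕ; zero; suc; _+_; _*_; _<ᵇ_; _/_)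
open import Data.Nat.Combinatorics using (_C_)
open import Data.Bool using (Bool; true; false; if_then_else_; _∧_)
open import Data.List using (List; []; _∷_; _++_; [_]; concatMap; map; upTo; filter; length)
open import Data.Product using (_×_; _,_)
open import Relation.Binary.PropositionalEquality using (_≡_)
open import Relation.Nullary.Decidable using (Dec)
open import Data.Bool using (_≟_)

insertEverywhere : ℕ → List ℕ → List (List ℕ)
insertEverywhere x [] = [ x ∷ [] ]
insertEverywhere x (y ∷ ys) = (x ∷ y ∷ ys) ∷ map (y ∷_) (insertEverywhere x ys)

permutations : List ℕ → List (List ℕ)
permutations [] = [ [] ]
permutations (x ∷ xs) = concatMap (insertEverywhere x) (permutations xs)

deck : ℕ → List ℕ
deck n = map suc (upTo n)

-- A War state: Alice's hand (top first), Bob's hand (top first).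
-- Each of Bob's cards is tagged: true = from his original hand, false = won in a round.
State : Set
State = List ℕ × List (ℕ × Bool)

initial : List ℕ → State
initial [] = [] , []
initial (a ∷ as) = (a ∷ []) , map (λ c → c , true) as

-- One round with WL-putback (winner's card first, then loser's card, at bottom).
-- Only meaningful when both hands are nonempty.
step : State → State
step (a ∷ as , (b , _) ∷ bs) =
  if b <ᵇ a then (as ++ (a ∷ b ∷ []) , bs)
            else (as , bs ++ ((b , false) ∷ (a , false) ∷ []))
step s = s

-- singleUseLoss k s = true iff, starting from s, the game lasts exactly k rounds,
-- ends with Alice having no cards (Bob still holding cards), and in every round
-- played Bob plays a card from his original hand (never a card he won).
singleUseLoss : ℕ → State → Bool
singleUseLoss zero ([] , _ ∷ _) = true
singleUseLoss zero _ = false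
singleUseLoss (suc k) (a ∷ as , (b , orig) ∷ bs) =
  orig ∧ singleUseLoss k (step (a ∷ as , (b , orig) ∷ bs))
singleUseLoss (suc k) _ = false

countSingleUseLoss : ℕ → ℕ → ℕ
countSingleUseLoss n R =
  length (filter (λ p → singleUseLoss R (initial p) Data.Bool.≟ true) (permutations (deck n)))

catalan : ℕ → ℕ
catalan r = ((2 * r) C r) / suc r

-- Once Bob's deal is summed over all orders, the number of losing deals depends only on the
-- multiset of Alice's cards. Exchanging Alice's and Bob's cards of a round therefore matches the
-- deals in which Alice wins that round with those in which she loses it, so Alice's hand size
-- performs a simple random walk from 1; with R ≤ n − 1 Bob never has to play a won card before the
-- end. Alice loses after exactly R rounds when the walk first hits 0 at time R, and by the
-- reflection principle, for R = 2r + 1 this happens for C(2r, r) − C(2r, r + 1) = C_r of the 2^R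
-- sign sequences.
module Submission where

open import Defs
open import Data.Bool using (Bool; true; false; not; if_then_else_; _∨_)
import Data.Bool
open import Data.Bool.Properties using (∨-zeroʳ)
open import Data.Empty using (⊥-elim)
open import Data.List using (List; []; _∷_; _++_; [_]; map; length; filter; null; concatMap; upTo; applyUpTo)
open import Data.List.Properties using (++-assoc; ++-identityʳ; map-++; map-∘; map-cong; length-map; length-upTo)
open import Data.List.Relation.Binary.Permutation.Propositional as ↭
  using (_↭_; ↭-refl; ↭-prep; ↭-swap; ↭-trans)
open import Data.List.Relation.Binary.Permutation.Propositional.Properties
  using (↭-length; All-resp-↭; ++⁺ʳ; ++⁺; ++-comm)
open import Data.List.Relation.Unary.All using (_∷_)
open import Data.List.Relation.Unary.AllPairs using (_∷_)
open import Data.List.Relation.Unary.Unique.Propositional using (Unique)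
open import Data.List.Relation.Unary.Unique.Propositional.Properties using (map⁺; upTo⁺)
open import Data.Nat using (ℕ; zero; suc; _+_; _*_; _^_; _<ᵇ_; _≤_; _<_; s≤s; z≤n; _%_; _/_; _∸_; _!)
open import Data.Nat.Combinatorics using (_C_; nCk+nC[k+1]≡[n+1]C[k+1]; k>n⇒nCk≡0; nCk≡nC[n∸k]; nC1≡n)
open import Data.Nat.DivMod using (m≡m%n+[m/n]*n; m*n/n≡m)
open import Data.Nat.ListAction using (sum)
open import Data.Nat.ListAction.Properties using (sum-++)
open import Data.Nat.Properties
open import Data.Nat.Tactic.RingSolver using (solve-∀)
open import Data.Product using (_,_)
open import Function using (_∘_)
open import Relation.Binary.PropositionalEquality
  using (_≡_; _≢_; refl; sym; trans; cong; cong₂; subst; subst₂; ≢-sym; module ≡-Reasoning)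
open ≡-Reasoning
open import Algebra.Properties.CommutativeSemigroup +-commutativeSemigroup using (interchange; x∙yz≈y∙xz)

𝟙 : Bool → ℕ
𝟙 true  = 1
𝟙 false = 0

data Pick {A : Set} : A → List A → List A → Set where
  here  : ∀ {x xs} → Pick x xs (x ∷ xs)
  there : ∀ {x y ys xs} → Pick y ys xs → Pick y (x ∷ ys) (x ∷ xs)

module _ {A : Set} where

  pick-↭ : ∀ {y : A} {ys xs} → Pick y ys xs → xs ↭ y ∷ ys
  pick-↭ here      = ↭-refl
  pick-↭ (there p) = ↭-trans (↭-prep _ (pick-↭ p)) (↭-swap _ _ ↭-refl)

  pick-length : ∀ {y : A} {ys xs} → Pick y ys xs → length xs ≡ suc (length ys)
  pick-length p = ↭-length (pick-↭ p)

  pick-unique : ∀ {y : A} {ys xs} → Pick y ys xs → Unique xs → Unique (y ∷ ys)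
  pick-unique here u = u
  pick-unique (there p) (x≢xs ∷ u) with All-resp-↭ (pick-↭ p) x≢xs | pick-unique p u
  ... | x≢y ∷ x≢ys | y≢ys ∷ uys = (≢-sym x≢y ∷ y≢ys) ∷ (x≢ys ∷ uys)

  pick-unique-rest : ∀ {y : A} {ys xs} → Pick y ys xs → Unique xs → Unique ys
  pick-unique-rest p u with pick-unique p u
  ... | _ ∷ uys = uys

  pick₂-distinct : ∀ {y z : A} {xs ys zs} →
    Unique xs → Pick y ys xs → Pick z zs ys → y ≢ z
  pick₂-distinct u p q with pick-unique p u
  ... | y≢ys ∷ _ with All-resp-↭ (pick-↭ q) y≢ys
  ...   | y≢z ∷ _ = y≢z

  ∑pick : List A → (A → List A → ℕ) → ℕ
  ∑pick []       g = 0
  ∑pick (x ∷ xs) g = g x xs + ∑pick xs (λ y ys → g y (x ∷ ys))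

  ∑pick-cong : ∀ (xs : List A) {g h : A → List A → ℕ} →
    (∀ {y ys} → Pick y ys xs → g y ys ≡ h y ys) → ∑pick xs g ≡ ∑pick xs h
  ∑pick-cong []       e = refl
  ∑pick-cong (x ∷ xs) e = cong₂ _+_ (e here) (∑pick-cong xs (λ p → e (there p)))

  ∑pick-+ : ∀ (xs : List A) (g h : A → List A → ℕ) →
    ∑pick xs (λ y ys → g y ys + h y ys) ≡ ∑pick xs g + ∑pick xs h
  ∑pick-+ []       g h = refl
  ∑pick-+ (x ∷ xs) g h =
    trans (cong (g x xs + h x xs +_) (∑pick-+ xs (λ y ys → g y (x ∷ ys)) (λ y ys → h y (x ∷ ys))))
          (interchange (g x xs) (h x xs) _ _)

  *-distribˡ-∑pick : ∀ c (xs : List A) (g : A → List A → ℕ) →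
    c * ∑pick xs g ≡ ∑pick xs (λ y ys → c * g y ys)
  *-distribˡ-∑pick c []       g = *-zeroʳ c
  *-distribˡ-∑pick c (x ∷ xs) g = trans (*-distribˡ-+ c (g x xs) _) (cong (c * g x xs +_) (*-distribˡ-∑pick c xs _))

  ∑pick-const : ∀ (xs : List A) {g : A → List A → ℕ} c →
    (∀ {y ys} → Pick y ys xs → g y ys ≡ c) → ∑pick xs g ≡ length xs * c
  ∑pick-const []       c e = refl
  ∑pick-const (x ∷ xs) c e = cong₂ _+_ (e here) (∑pick-const xs c (λ p → e (there p)))

  ∑pick-comm : ∀ (xs : List A) (F : A → A → List A → ℕ) →
    ∑pick xs (λ y ys → ∑pick ys (F y)) ≡ ∑pick xs (λ y ys → ∑pick ys (λ z → F z y))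
  ∑pick-comm []       F = refl
  ∑pick-comm (v ∷ vs) F = begin
    P + ∑pick vs (λ y ys → F y v ys + ∑pick ys (λ z zs → F y z (v ∷ zs)))
      ≡⟨ cong (P +_) (∑pick-+ vs _ _) ⟩
    P + (Q + ∑pick vs (λ y ys → ∑pick ys (λ z zs → F y z (v ∷ zs))))
      ≡⟨ cong (λ s → P + (Q + s)) (∑pick-comm vs (λ y z zs → F y z (v ∷ zs))) ⟩
    P + (Q + ∑pick vs (λ y ys → ∑pick ys (λ z zs → F z y (v ∷ zs))))
      ≡⟨ x∙yz≈y∙xz P Q _ ⟩
    Q + (P + ∑pick vs (λ y ys → ∑pick ys (λ z zs → F z y (v ∷ zs))))
      ≡⟨ cong (Q +_) (∑pick-+ vs _ _) ⟨
    Q + ∑pick vs (λ y ys → F v y ys + ∑pick ys (λ z zs → F z y (v ∷ zs))) ∎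
    where
    P = ∑pick vs (F v)
    Q = ∑pick vs (λ y ys → F y v ys)

  *-∑pick₂-const : ∀ a (xs : List A) m (g : List A → ℕ) c → length xs ≡ suc (suc m) →
    (∀ {y ys z zs} → Pick y ys xs → Pick z zs ys → length zs ≡ m → a * g zs ≡ m ! * c) →
    a * ∑pick xs (λ _ ys → ∑pick ys (λ _ zs → g zs)) ≡ suc (suc m) ! * c
  *-∑pick₂-const a xs m g c len e = begin
    a * ∑pick xs (λ _ ys → ∑pick ys (λ _ zs → g zs))   ≡⟨ *-distribˡ-∑pick a xs _ ⟩
    ∑pick xs (λ _ ys → a * ∑pick ys (λ _ zs → g zs))   ≡⟨ ∑pick-const xs (suc m * (m ! * c)) second-pick ⟩
    length xs * (suc m * (m ! * c))                     ≡⟨ cong (_* (suc m * (m ! * c))) len ⟩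
    suc (suc m) * (suc m * (m ! * c))                   ≡⟨ cong (suc (suc m) *_) (*-assoc (suc m) (m !) c) ⟨
    suc (suc m) * (suc m ! * c)                         ≡⟨ *-assoc (suc (suc m)) (suc m !) c ⟨
    suc (suc m) ! * c                                   ∎
    where
    second-pick : ∀ {y ys} → Pick y ys xs → a * ∑pick ys (λ _ zs → g zs) ≡ suc m * (m ! * c)
    second-pick {ys = ys} p = begin
      a * ∑pick ys (λ _ zs → g zs)   ≡⟨ *-distribˡ-∑pick a ys (λ _ zs → g zs) ⟩
      ∑pick ys (λ _ zs → a * g zs)   ≡⟨ ∑pick-const ys (m ! * c) (λ q → e p q (zs-length q)) ⟩
      length ys * (m ! * c)          ≡⟨ cong (_* (m ! * c)) ys-length ⟩
      suc m * (m ! * c)              ∎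
      where
      ys-length : length ys ≡ suc m
      ys-length = suc-injective (trans (sym (pick-length p)) len)
      zs-length : ∀ {z zs} → Pick z zs ys → length zs ≡ m
      zs-length q = suc-injective (trans (sym (pick-length q)) ys-length)

-- Sums over permutations

∑perm : List ℕ → (List ℕ → ℕ) → ℕ
∑perm xs f = sum (map f (permutations xs))

∑perm-cong : ∀ xs {f g : List ℕ → ℕ} → (∀ p → f p ≡ g p) → ∑perm xs f ≡ ∑perm xs g
∑perm-cong xs e = cong sum (map-cong e (permutations xs))

∑perm-+ : ∀ xs (f g : List ℕ → ℕ) → ∑perm xs (λ p → f p + g p) ≡ ∑perm xs f + ∑perm xs g
∑perm-+ xs f g = sum-map-+ (permutations xs)
  where
  sum-map-+ : ∀ ps → sum (map (λ p → f p + g p) ps) ≡ sum (map f ps) + sum (map g ps)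
  sum-map-+ []       = refl
  sum-map-+ (p ∷ ps) = trans (cong (f p + g p +_) (sum-map-+ ps)) (interchange (f p) (g p) _ _)

∑insert : ℕ → List ℕ → (List ℕ → ℕ) → ℕ
∑insert x q f = sum (map f (insertEverywhere x q))

∑insert-∷ : ∀ x y q f → ∑insert x (y ∷ q) f ≡ f (x ∷ y ∷ q) + ∑insert x q (f ∘ (y ∷_))
∑insert-∷ x y q f = cong (λ l → f (x ∷ y ∷ q) + sum l) (sym (map-∘ (insertEverywhere x q)))

∑perm-∷ : ∀ x xs f → ∑perm (x ∷ xs) f ≡ ∑perm xs (λ q → ∑insert x q f)
∑perm-∷ x xs f = sum-map-concatMap (permutations xs)
  where
  sum-map-concatMap : ∀ qs → sum (map f (concatMap (insertEverywhere x) qs)) ≡ sum (map (λ q → ∑insert x q f) qs)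
  sum-map-concatMap []       = refl
  sum-map-concatMap (q ∷ qs) = begin
    sum (map f (insertEverywhere x q ++ concatMap (insertEverywhere x) qs))
      ≡⟨ cong sum (map-++ f (insertEverywhere x q) _) ⟩
    sum (map f (insertEverywhere x q) ++ map f (concatMap (insertEverywhere x) qs))
      ≡⟨ sum-++ (map f (insertEverywhere x q)) _ ⟩
    ∑insert x q f + sum (map f (concatMap (insertEverywhere x) qs))
      ≡⟨ cong (∑insert x q f +_) (sum-map-concatMap qs) ⟩
    ∑insert x q f + sum (map (λ q → ∑insert x q f) qs) ∎

∑perm-by-first : ∀ x xs f → ∑perm (x ∷ xs) f ≡ ∑pick (x ∷ xs) (λ y ys → ∑perm ys (f ∘ (y ∷_)))
∑perm-by-first x []       f = sym (+-identityʳ _)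
∑perm-by-first x (z ∷ zs) f = begin
  ∑perm (x ∷ xs) f                                         ≡⟨ ∑perm-∷ x xs f ⟩
  ∑perm xs (λ q → ∑insert x q f)                           ≡⟨ ∑perm-cong xs insert-first ⟩
  ∑perm xs (λ q → f (x ∷ q) + insert-later q)              ≡⟨ ∑perm-+ xs _ insert-later ⟩
  ∑perm xs (f ∘ (x ∷_)) + ∑perm xs insert-later            ≡⟨ cong (∑perm xs (f ∘ (x ∷_)) +_) later-by-first ⟩
  ∑perm xs (f ∘ (x ∷_)) + ∑pick xs (λ y ys → ∑perm (x ∷ ys) (f ∘ (y ∷_))) ∎
  where
  xs = z ∷ zs
  insert-later : List ℕ → ℕ
  insert-later []      = 0
  insert-later (y ∷ q) = ∑insert x q (f ∘ (y ∷_))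
  insert-first : ∀ q → ∑insert x q f ≡ f (x ∷ q) + insert-later q
  insert-first []      = refl
  insert-first (y ∷ q) = ∑insert-∷ x y q f
  later-by-first : ∑perm xs insert-later ≡ ∑pick xs (λ y ys → ∑perm (x ∷ ys) (f ∘ (y ∷_)))
  later-by-first = trans (∑perm-by-first z zs insert-later)
                         (∑pick-cong xs (λ {y} {ys} _ → sym (∑perm-∷ x ys (f ∘ (y ∷_)))))

∑perm-by-first₂ : ∀ xs f → f [] ≡ 0 → (∀ b → f [ b ] ≡ 0) →
  ∑perm xs f ≡ ∑pick xs (λ b ys → ∑pick ys (λ b′ zs → ∑perm zs (f ∘ (λ B → b ∷ b′ ∷ B))))
∑perm-by-first₂ []       f f[]≡0 _      = cong (_+ 0) f[]≡0
∑perm-by-first₂ (x ∷ xs) f _     f[b]≡0 = trans (∑perm-by-first x xs f) (∑pick-cong (x ∷ xs) by-second)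
  where
  by-second : ∀ {y ys} → Pick y ys (x ∷ xs) →
    ∑perm ys (f ∘ (y ∷_)) ≡ ∑pick ys (λ b′ zs → ∑perm zs (f ∘ (λ B → y ∷ b′ ∷ B)))
  by-second {y} {[]}     _ = cong (_+ 0) (f[b]≡0 y)
  by-second {y} {z ∷ zs} _ = ∑perm-by-first z zs (f ∘ (y ∷_))

∑perm-const : ∀ n xs c → length xs ≡ n → ∑perm xs (λ _ → c) ≡ n ! * c
∑perm-const zero    []       c _ = refl
∑perm-const (suc n) (x ∷ xs) c e = begin
  ∑perm (x ∷ xs) (λ _ → c)                       ≡⟨ ∑perm-by-first x xs (λ _ → c) ⟩
  ∑pick (x ∷ xs) (λ _ ys → ∑perm ys (λ _ → c))   ≡⟨ ∑pick-const (x ∷ xs) (n ! * c) rest ⟩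
  length (x ∷ xs) * (n ! * c)                    ≡⟨ cong (_* (n ! * c)) e ⟩
  suc n * (n ! * c)                              ≡⟨ *-assoc (suc n) (n !) c ⟨
  suc n ! * c                                    ∎
  where
  rest : ∀ {y ys} → Pick y ys (x ∷ xs) → ∑perm ys (λ _ → c) ≡ n ! * c
  rest {ys = ys} p = ∑perm-const n ys c (suc-injective (trans (sym (pick-length p)) e))

-- ∑hand k U F sums F Q B over the ordered k-tuples Q drawn from U and the orders B of the rest.
∑hand : ℕ → List ℕ → (List ℕ → List ℕ → ℕ) → ℕ
∑hand zero    U F = ∑perm U (F [])
∑hand (suc k) U F = ∑pick U (λ q U′ → ∑hand k U′ (λ Q → F (q ∷ Q)))

∑hand-cong : ∀ k U {F G : List ℕ → List ℕ → ℕ} →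
  (∀ Q V → ∑perm V (F Q) ≡ ∑perm V (G Q)) → ∑hand k U F ≡ ∑hand k U G
∑hand-cong zero    U e = e [] U
∑hand-cong (suc k) U e = ∑pick-cong U (λ {q} {U′} _ → ∑hand-cong k U′ (λ Q → e (q ∷ Q)))

∑hand-zero : ∀ k U → ∑hand k U (λ _ _ → 0) ≡ 0
∑hand-zero zero    U = trans (∑perm-const (length U) U 0 refl) (*-zeroʳ (length U !))
∑hand-zero (suc k) U = trans (∑pick-const U 0 (λ {_} {U′} _ → ∑hand-zero k U′)) (*-zeroʳ (length U))

∑hand-by-first : ∀ k U F → suc k ≤ length U →
  ∑hand k U F ≡ ∑pick U (λ b U′ → ∑hand k U′ (λ Q B → F Q (b ∷ B)))
∑hand-by-first zero    (x ∷ xs) F _  = ∑perm-by-first x xs (F [])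
∑hand-by-first (suc k) U        F le = begin
  ∑pick U (λ q U′ → ∑hand k U′ (λ Q → F (q ∷ Q)))
    ≡⟨ ∑pick-cong U (λ {q} {U′} p → ∑hand-by-first k U′ (λ Q → F (q ∷ Q)) (shorter p)) ⟩
  ∑pick U (λ q U′ → ∑pick U′ (λ b U″ → ∑hand k U″ (λ Q B → F (q ∷ Q) (b ∷ B))))
    ≡⟨ ∑pick-comm U (λ q b U″ → ∑hand k U″ (λ Q B → F (q ∷ Q) (b ∷ B))) ⟩
  ∑pick U (λ b U′ → ∑pick U′ (λ q U″ → ∑hand k U″ (λ Q B → F (q ∷ Q) (b ∷ B)))) ∎
  where
  shorter : ∀ {q U′} → Pick q U′ U → suc k ≤ length U′
  shorter p = ≤-pred (subst (suc (suc k) ≤_) (pick-length p) le)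

-- The single-use game

-- loss R Q B w: Alice holds Q, Bob holds his original cards B above his won cards,
-- of which he has some iff w; Alice loses, single-use, after exactly R rounds.
loss : ℕ → List ℕ → List ℕ → Bool → Bool
loss zero    []      B       w = w ∨ not (null B)
loss zero    (_ ∷ _) _       _ = false
loss (suc R) []      _       _ = false
loss (suc R) (_ ∷ _) []      _ = false
loss (suc R) (q ∷ Q) (b ∷ B) w =
  if b <ᵇ q then loss R (Q ++ q ∷ b ∷ []) B w else loss R Q B true

singleUseLoss-tagged : ∀ R Q B W →
  singleUseLoss R (Q , map (_, true) B ++ map (_, false) W) ≡ loss R Q B (not (null W))
singleUseLoss-tagged zero    []      []      []      = refl
singleUseLoss-tagged zero    []      []      (_ ∷ _) = refl
singleUseLoss-tagged zero    []      (_ ∷ _) W       = sym (∨-zeroʳ _)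
singleUseLoss-tagged zero    (_ ∷ _) _       _       = refl
singleUseLoss-tagged (suc R) []      _       _       = refl
singleUseLoss-tagged (suc R) (_ ∷ _) []      []      = refl
singleUseLoss-tagged (suc R) (_ ∷ _) []      (_ ∷ _) = refl
singleUseLoss-tagged (suc R) (q ∷ Q) (b ∷ B) W with b <ᵇ q
... | true  = singleUseLoss-tagged R (Q ++ q ∷ b ∷ []) B W
... | false = begin
  singleUseLoss R (Q , (map (_, true) B ++ map (_, false) W) ++ map (_, false) (b ∷ q ∷ []))
    ≡⟨ cong (λ bob → singleUseLoss R (Q , bob)) bob-piles ⟩
  singleUseLoss R (Q , map (_, true) B ++ map (_, false) (W ++ b ∷ q ∷ []))
    ≡⟨ singleUseLoss-tagged R Q B (W ++ b ∷ q ∷ []) ⟩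
  loss R Q B (not (null (W ++ b ∷ q ∷ [])))
    ≡⟨ cong (loss R Q B) (won-nonempty W) ⟩
  loss R Q B true ∎
  where
  bob-piles : (map (_, true) B ++ map (_, false) W) ++ map (_, false) (b ∷ q ∷ [])
            ≡ map (_, true) B ++ map (_, false) (W ++ b ∷ q ∷ [])
  bob-piles = trans (++-assoc (map (_, true) B) _ _) (cong (map (_, true) B ++_) (sym (map-++ (_, false) W _)))
  won-nonempty : ∀ W → not (null (W ++ b ∷ q ∷ [])) ≡ true
  won-nonempty []      = refl
  won-nonempty (_ ∷ _) = refl

singleUseLoss-initial : ∀ R a as → singleUseLoss R (initial (a ∷ as)) ≡ loss R (a ∷ []) as false
singleUseLoss-initial R a as =
  trans (cong (λ bob → singleUseLoss R (a ∷ [] , bob)) (sym (++-identityʳ _)))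
        (singleUseLoss-tagged R (a ∷ []) as [])

lossCount : ℕ → List ℕ → Bool → List ℕ → ℕ
lossCount R Q w V = ∑perm V (λ B → 𝟙 (loss R Q B w))

loss-final-↭ : ∀ {Q Q′} → Q ↭ Q′ → ∀ B w → loss zero Q B w ≡ loss zero Q′ B w
loss-final-↭ ↭.refl          B w = refl
loss-final-↭ (↭.prep _ _)    B w = refl
loss-final-↭ (↭.swap _ _ _)  B w = refl
loss-final-↭ (↭.trans p₁ p₂) B w = trans (loss-final-↭ p₁ B w) (loss-final-↭ p₂ B w)

lossCount-↭ : ∀ R w V {Q Q′} → Q ↭ Q′ → lossCount R Q w V ≡ lossCount R Q′ w V
lossCount-↭ zero          w V p = ∑perm-cong V (λ B → cong 𝟙 (loss-final-↭ p B w))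
lossCount-↭ (suc R)       w V ↭.refl = refl
lossCount-↭ (suc R)       w V (↭.trans p₁ p₂) = trans (lossCount-↭ (suc R) w V p₁) (lossCount-↭ (suc R) w V p₂)
lossCount-↭ (suc R)       w [] (↭.prep x p) = refl
lossCount-↭ (suc R)       w (v ∷ vs) (↭.prep {xs} {ys} x p) =
  trans (∑perm-by-first v vs _) (trans (∑pick-cong (v ∷ vs) first-round) (sym (∑perm-by-first v vs _)))
  where
  first-round : ∀ {b V′} → Pick b V′ (v ∷ vs) →
    ∑perm V′ (λ B → 𝟙 (loss (suc R) (x ∷ xs) (b ∷ B) w))
      ≡ ∑perm V′ (λ B → 𝟙 (loss (suc R) (x ∷ ys) (b ∷ B) w))
  first-round {b} {V′} _ with b <ᵇ x
  ... | true  = lossCount-↭ R w V′ (++⁺ʳ (x ∷ b ∷ []) p)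
  ... | false = lossCount-↭ R true V′ p
lossCount-↭ (suc zero)    w V (↭.swap {xs} {ys} x y p) =
  trans (∑perm-cong V (λ B → cong 𝟙 (one-round x y xs B)))
        (sym (∑perm-cong V (λ B → cong 𝟙 (one-round y x ys B))))
  where
  one-round : ∀ x y xs B → loss 1 (x ∷ y ∷ xs) B w ≡ false
  one-round x y xs []      = refl
  one-round x y xs (b ∷ B) with b <ᵇ x
  ... | true  = refl
  ... | false = refl
lossCount-↭ (suc (suc R)) w V (↭.swap {xs} {ys} x y p) = begin
  lossCount (2 + R) (x ∷ y ∷ xs) w V
    ≡⟨ ∑perm-by-first₂ V _ refl (bob-short x y xs) ⟩
  ∑pick V (λ b V′ → ∑pick V′ (λ b′ → two-rounds-from (x ∷ y ∷ xs) b b′))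
    ≡⟨ ∑pick-cong V (λ {b} {V′} _ → ∑pick-cong V′ (λ {b′} {V″} _ → two-rounds-swap b b′ V″)) ⟩
  ∑pick V (λ b V′ → ∑pick V′ (λ b′ → two-rounds-from (y ∷ x ∷ ys) b′ b))
    ≡⟨ ∑pick-comm V (two-rounds-from (y ∷ x ∷ ys)) ⟨
  ∑pick V (λ b V′ → ∑pick V′ (λ b′ → two-rounds-from (y ∷ x ∷ ys) b b′))
    ≡⟨ ∑perm-by-first₂ V _ refl (bob-short y x ys) ⟨
  lossCount (2 + R) (y ∷ x ∷ ys) w V ∎
  where
  two-rounds-from : List ℕ → ℕ → ℕ → List ℕ → ℕ
  two-rounds-from Q b b′ V″ = ∑perm V″ (λ B → 𝟙 (loss (2 + R) Q (b ∷ b′ ∷ B) w))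
  bob-short : ∀ x y xs b → 𝟙 (loss (2 + R) (x ∷ y ∷ xs) (b ∷ []) w) ≡ 0
  bob-short x y xs b with b <ᵇ x
  ... | true  = refl
  ... | false = refl
  -- The two rounds pit x against b and y against b′; their outcomes do not depend on the order.
  two-rounds-swap : ∀ b b′ V″ →
    two-rounds-from (x ∷ y ∷ xs) b b′ V″ ≡ two-rounds-from (y ∷ x ∷ ys) b′ b V″
  two-rounds-swap b b′ V″ with b <ᵇ x | b′ <ᵇ y
  ... | true  | true  = lossCount-↭ R w V″ (subst₂ _↭_ (sym (++-assoc xs _ _)) (sym (++-assoc ys _ _))
                                              (++⁺ p (++-comm (x ∷ b ∷ []) (y ∷ b′ ∷ []))))
  ... | true  | false = lossCount-↭ R true V″ (++⁺ʳ _ p)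
  ... | false | true  = lossCount-↭ R true V″ (++⁺ʳ _ p)
  ... | false | false = lossCount-↭ R true V″ p

lossTotal : ℕ → Bool → ℕ → List ℕ → ℕ
lossTotal R w k U = ∑hand k U (λ Q B → 𝟙 (loss R Q B w))

<ᵇ-flip : ∀ m n → m ≢ n → (m <ᵇ n) ≡ not (n <ᵇ m)
<ᵇ-flip zero    zero    m≢n = ⊥-elim (m≢n refl)
<ᵇ-flip zero    (suc n) _   = refl
<ᵇ-flip (suc m) zero    _   = refl
<ᵇ-flip (suc m) (suc n) m≢n = <ᵇ-flip m n (m≢n ∘ cong suc)

-- Exchanging Alice's and Bob's first cards q ≠ b turns a won round into a lost one and back,
-- so the deals split evenly between the two outcomes of the first round.
lossTotal-round : ∀ R w k U → Unique U → suc (suc k) ≤ length U →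
  2 * lossTotal (suc R) w (suc k) U
    ≡ lossTotal R w (suc (suc k)) U + ∑pick U (λ _ U′ → ∑pick U′ (λ _ U″ → lossTotal R true k U″))
lossTotal-round R w k U u le = begin
  2 * lossTotal (suc R) w (suc k) U
    ≡⟨ cong (2 *_) first-round ⟩
  2 * S
    ≡⟨ cong (S +_) (+-identityʳ S) ⟩
  S + S
    ≡⟨ cong (S +_) (∑pick-comm U outcome) ⟩
  S + ∑pick U (λ q U′ → ∑pick U′ (λ b U″ → outcome b q U″))
    ≡⟨ ∑pick-+ U (λ q U′ → ∑pick U′ (outcome q)) _ ⟨
  ∑pick U (λ q U′ → ∑pick U′ (outcome q) + ∑pick U′ (λ b U″ → outcome b q U″))
    ≡⟨ ∑pick-cong U (λ {q} {U′} s → trans (sym (∑pick-+ U′ (outcome q) (λ b U″ → outcome b q U″)))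
                                          (∑pick-cong U′ (λ s′ → either-wins (pick₂-distinct u s s′)))) ⟩
  ∑pick U (λ q U′ → ∑pick U′ (λ b U″ → alice-wins q b U″ + lossTotal R true k U″))
    ≡⟨ ∑pick-cong U (λ {q} {U′} _ → ∑pick-+ U′ (alice-wins q) (λ _ U″ → lossTotal R true k U″)) ⟩
  ∑pick U (λ q U′ → ∑pick U′ (alice-wins q) + ∑pick U′ (λ _ U″ → lossTotal R true k U″))
    ≡⟨ ∑pick-+ U _ _ ⟩
  lossTotal R w (suc (suc k)) U + ∑pick U (λ _ U′ → ∑pick U′ (λ _ U″ → lossTotal R true k U″)) ∎
  where
  alice-wins : ℕ → ℕ → List ℕ → ℕ
  alice-wins q b U″ = ∑hand k U″ (λ Q B → 𝟙 (loss R (q ∷ b ∷ Q) B w))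
  outcome : ℕ → ℕ → List ℕ → ℕ
  outcome q b U″ = if b <ᵇ q then alice-wins q b U″ else lossTotal R true k U″
  S : ℕ
  S = ∑pick U (λ q U′ → ∑pick U′ (outcome q))

  first-round : lossTotal (suc R) w (suc k) U ≡ S
  first-round = ∑pick-cong U (λ {q} {U′} s →
    trans (∑hand-by-first k U′ (λ Q B → 𝟙 (loss (suc R) (q ∷ Q) B w)) (shorter s))
          (∑pick-cong U′ (λ {b} {U″} _ → played q b U″)))
    where
    shorter : ∀ {q U′} → Pick q U′ U → suc k ≤ length U′
    shorter s = ≤-pred (subst (suc (suc k) ≤_) (pick-length s) le)
    played : ∀ q b U″ → ∑hand k U″ (λ Q B → 𝟙 (loss (suc R) (q ∷ Q) (b ∷ B) w)) ≡ outcome q b U″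
    played q b U″ with b <ᵇ q
    ... | true  = ∑hand-cong k U″ (λ Q V → lossCount-↭ R w V (++-comm Q (q ∷ b ∷ [])))
    ... | false = refl

  either-wins : ∀ {q b U″} → q ≢ b →
    outcome q b U″ + outcome b q U″ ≡ alice-wins q b U″ + lossTotal R true k U″
  either-wins {q} {b} {U″} q≢b with q <ᵇ b | <ᵇ-flip q b q≢b
  ... | _ | refl with b <ᵇ q
  ...   | true  = refl
  ...   | false = trans (+-comm (lossTotal R true k U″) _)
                        (cong (_+ lossTotal R true k U″)
                              (∑hand-cong k U″ (λ Q V → lossCount-↭ R w V (↭-swap b q ↭-refl))))

-- firstPassage k R counts the walks with steps ±1 from k that first reach 0 after R steps.
firstPassage : ℕ → ℕ → ℕ
firstPassage zero    zero    = 1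
firstPassage (suc k) zero    = 0
firstPassage zero    (suc R) = 0
firstPassage (suc k) (suc R) = firstPassage (suc (suc k)) R + firstPassage k R

-- The last hypothesis excludes the final position in which neither player holds a card.
lossTotal≡firstPassage : ∀ R w k U → Unique U → k + R ≤ length U → (w ≡ false → 1 ≤ k) →
  2 ^ R * lossTotal R w k U ≡ length U ! * firstPassage k R
lossTotal≡firstPassage zero true zero U _ _ _ =
  trans (*-identityˡ _) (∑perm-const (length U) U 1 refl)
lossTotal≡firstPassage zero false zero U _ _ bob-holds-cards with bob-holds-cards refl
... | ()
lossTotal≡firstPassage zero w (suc k) U _ _ _ =
  trans (*-identityˡ _) (trans (∑hand-zero (suc k) U) (sym (*-zeroʳ (length U !))))
lossTotal≡firstPassage (suc R) w zero U _ _ _ =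
  trans (cong (2 ^ suc R *_) (∑hand-zero zero U)) (trans (*-zeroʳ (2 ^ suc R)) (sym (*-zeroʳ (length U !))))
lossTotal≡firstPassage (suc R) w (suc zero)    (_ ∷ []) _ (s≤s ()) _
lossTotal≡firstPassage (suc R) w (suc (suc k)) (_ ∷ []) _ (s≤s ()) _
lossTotal≡firstPassage (suc R) w (suc k) U@(_ ∷ _ ∷ zs) u le _ = begin
  2 ^ suc R * lossTotal (suc R) w (suc k) U
    ≡⟨ cong (_* lossTotal (suc R) w (suc k) U) (*-comm 2 (2 ^ R)) ⟩
  2 ^ R * 2 * lossTotal (suc R) w (suc k) U
    ≡⟨ *-assoc (2 ^ R) 2 _ ⟩
  2 ^ R * (2 * lossTotal (suc R) w (suc k) U)
    ≡⟨ cong (2 ^ R *_) (lossTotal-round R w k U u (≤-trans (s≤s (s≤s (m≤m+n k R))) le₂)) ⟩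
  2 ^ R * (lossTotal R w (suc (suc k)) U + ∑pick U (λ _ U′ → ∑pick U′ (λ _ U″ → lossTotal R true k U″)))
    ≡⟨ *-distribˡ-+ (2 ^ R) _ _ ⟩
  2 ^ R * lossTotal R w (suc (suc k)) U + 2 ^ R * ∑pick U (λ _ U′ → ∑pick U′ (λ _ U″ → lossTotal R true k U″))
    ≡⟨ cong₂ _+_ (lossTotal≡firstPassage R w (suc (suc k)) U u le₂ (λ _ → s≤s z≤n)) alice-loses ⟩
  length U ! * firstPassage (suc (suc k)) R + length U ! * firstPassage k R
    ≡⟨ *-distribˡ-+ (length U !) _ _ ⟨
  length U ! * firstPassage (suc k) (suc R) ∎
  where
  le₂ : suc (suc k) + R ≤ length U
  le₂ = subst (_≤ length U) (+-suc (suc k) R) le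
  alice-loses : 2 ^ R * ∑pick U (λ _ U′ → ∑pick U′ (λ _ U″ → lossTotal R true k U″))
              ≡ length U ! * firstPassage k R
  alice-loses = *-∑pick₂-const (2 ^ R) U (length zs) (lossTotal R true k) (firstPassage k R) refl
    (λ {_} {_} {_} {U″} s s′ len → trans
      (lossTotal≡firstPassage R true k U″ (pick-unique-rest s′ (pick-unique-rest s u))
         (subst (k + R ≤_) (sym len) (≤-pred (≤-pred le₂))) λ ())
      (cong (λ l → l ! * firstPassage k R) len))

-- Ballot numbers

firstPassage-below : ∀ k R → R < k → firstPassage k R ≡ 0
firstPassage-below (suc k) zero    _         = refl
firstPassage-below (suc k) (suc R) (s≤s R<k) =
  cong₂ _+_ (firstPassage-below (suc (suc k)) R (m<n⇒m<1+n (m<n⇒m<1+n R<k))) (firstPassage-below k R R<k)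

ballot : ℕ → ℕ → ℕ
ballot zero    j       = 1
ballot (suc u) zero    = ballot u 1
ballot (suc u) (suc j) = ballot u (suc (suc j)) + ballot (suc u) j

firstPassage≡ballot : ∀ u j → firstPassage (suc j) (suc (j + (u + u))) ≡ ballot u j
firstPassage≡ballot zero    zero    = refl
firstPassage≡ballot zero    (suc j) =
  cong₂ _+_ (firstPassage-below (3 + j) (suc j + 0) (s≤s (s≤s (m≤n⇒m≤1+n (≤-reflexive (+-identityʳ j))))))
            (firstPassage≡ballot zero j)
firstPassage≡ballot (suc u) zero    =
  trans (+-identityʳ _) (trans (cong (λ r → firstPassage 2 (suc r)) (+-suc u u)) (firstPassage≡ballot u 1))
firstPassage≡ballot (suc u) (suc j) =
  cong₂ _+_ (trans (cong (firstPassage (3 + j)) (steps u j)) (firstPassage≡ballot u (2 + j)))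
            (firstPassage≡ballot (suc u) j)
  where
  steps : ∀ u j → suc j + (suc u + suc u) ≡ suc (2 + j + (u + u))
  steps = solve-∀

-- The reflection principle: the walks that reach 0 too early are counted by the second binomial.
ballot-reflection : ∀ u j → ballot u j + (u + u + j) C (u + j + 1) ≡ (u + u + j) C u
ballot-reflection zero    j = cong suc (k>n⇒nCk≡0 (subst (j <_) (+-comm 1 j) (n<1+n j)))
ballot-reflection (suc u) zero = begin
  ballot u 1 + (suc u + suc u + 0) C (suc u + 0 + 1)
    ≡⟨ cong₂ (λ n k → ballot u 1 + n C k) (top u) (bottom u) ⟩
  ballot u 1 + suc M C suc (suc u)
    ≡⟨ cong (ballot u 1 +_) (nCk+nC[k+1]≡[n+1]C[k+1] M (suc u)) ⟨
  ballot u 1 + (M C suc u + M C suc (suc u))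
    ≡⟨ rearrange (ballot u 1) (M C suc u) (M C suc (suc u)) ⟩
  (ballot u 1 + M C suc (suc u)) + M C suc u
    ≡⟨ cong (λ k → (ballot u 1 + M C k) + M C suc u) (bottom′ u) ⟨
  (ballot u 1 + M C (u + 1 + 1)) + M C suc u
    ≡⟨ cong (_+ M C suc u) (ballot-reflection u 1) ⟩
  M C u + M C suc u
    ≡⟨ nCk+nC[k+1]≡[n+1]C[k+1] M u ⟩
  suc M C suc u
    ≡⟨ cong (_C suc u) (top u) ⟨
  (suc u + suc u + 0) C suc u ∎
  where
  M = u + u + 1
  top : ∀ u → suc u + suc u + 0 ≡ suc (u + u + 1)
  top = solve-∀
  bottom : ∀ u → suc u + 0 + 1 ≡ suc (suc u)
  bottom = solve-∀
  bottom′ : ∀ u → u + 1 + 1 ≡ suc (suc u)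
  bottom′ = solve-∀
  rearrange : ∀ a b c → a + (b + c) ≡ (a + c) + b
  rearrange = solve-∀
ballot-reflection (suc u) (suc j) = begin
  (B₁ + B₂) + (suc u + suc u + suc j) C (suc u + suc j + 1)
    ≡⟨ cong₂ (λ n k → (B₁ + B₂) + n C k) (top u j) (bottom u j) ⟩
  (B₁ + B₂) + suc M C suc K
    ≡⟨ cong ((B₁ + B₂) +_) (nCk+nC[k+1]≡[n+1]C[k+1] M K) ⟨
  (B₁ + B₂) + (M C K + M C suc K)
    ≡⟨ rearrange B₁ B₂ (M C K) (M C suc K) ⟩
  (B₁ + M C suc K) + (B₂ + M C K)
    ≡⟨ cong₂ (λ k k′ → (B₁ + M C k) + (B₂ + M C k′)) (bottom₁ u j) (bottom₂ u j) ⟨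
  (B₁ + M C (u + suc (suc j) + 1)) + (B₂ + M C (suc u + j + 1))
    ≡⟨ cong₂ _+_ (trans (cong (λ n → B₁ + n C (u + suc (suc j) + 1)) (sym (top₁ u j)))
                        (ballot-reflection u (suc (suc j))))
                 (trans (cong (λ n → B₂ + n C (suc u + j + 1)) (sym (top₂ u j)))
                        (ballot-reflection (suc u) j)) ⟩
  (u + u + suc (suc j)) C u + (suc u + suc u + j) C suc u
    ≡⟨ cong₂ (λ n n′ → n C u + n′ C suc u) (top₁ u j) (top₂ u j) ⟩
  M C u + M C suc u
    ≡⟨ nCk+nC[k+1]≡[n+1]C[k+1] M u ⟩
  suc M C suc u
    ≡⟨ cong (_C suc u) (top u j) ⟨
  (suc u + suc u + suc j) C suc u ∎
  where
  M = u + u + j + 2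
  K = u + j + 2
  B₁ = ballot u (suc (suc j))
  B₂ = ballot (suc u) j
  top : ∀ u j → suc u + suc u + suc j ≡ suc (u + u + j + 2)
  top = solve-∀
  top₁ : ∀ u j → u + u + suc (suc j) ≡ u + u + j + 2
  top₁ = solve-∀
  top₂ : ∀ u j → suc u + suc u + j ≡ u + u + j + 2
  top₂ = solve-∀
  bottom : ∀ u j → suc u + suc j + 1 ≡ suc (u + j + 2)
  bottom = solve-∀
  bottom₁ : ∀ u j → u + suc (suc j) + 1 ≡ suc (u + j + 2)
  bottom₁ = solve-∀
  bottom₂ : ∀ u j → suc u + j + 1 ≡ u + j + 2
  bottom₂ = solve-∀
  rearrange : ∀ a b c d → (a + b) + (c + d) ≡ (a + d) + (b + c)
  rearrange = solve-∀

[k+1]*[n+1]C[k+1]≡[n+1]*nCk : ∀ n k → suc k * (suc n C suc k) ≡ suc n * (n C k)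
[k+1]*[n+1]C[k+1]≡[n+1]*nCk n       zero    =
  trans (+-identityʳ _) (trans (nC1≡n (suc n)) (sym (*-identityʳ (suc n))))
[k+1]*[n+1]C[k+1]≡[n+1]*nCk zero    (suc k) =
  trans (cong (suc (suc k) *_) (k>n⇒nCk≡0 {1} {suc (suc k)} (s≤s (s≤s z≤n))))
        (trans (*-zeroʳ (suc (suc k))) (sym (cong (1 *_) (k>n⇒nCk≡0 {0} {suc k} (s≤s z≤n)))))
[k+1]*[n+1]C[k+1]≡[n+1]*nCk (suc n) (suc k) = begin
  suc (suc k) * (suc (suc n) C suc (suc k))
    ≡⟨ cong (suc (suc k) *_) (nCk+nC[k+1]≡[n+1]C[k+1] (suc n) (suc k)) ⟨
  suc (suc k) * (A + B)
    ≡⟨ *-distribˡ-+ (suc (suc k)) A B ⟩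
  A + suc k * A + suc (suc k) * B
    ≡⟨ cong₂ (λ a b → A + a + b) ([k+1]*[n+1]C[k+1]≡[n+1]*nCk n k) ([k+1]*[n+1]C[k+1]≡[n+1]*nCk n (suc k)) ⟩
  A + suc n * (n C k) + suc n * (n C suc k)
    ≡⟨ +-assoc A _ _ ⟩
  A + (suc n * (n C k) + suc n * (n C suc k))
    ≡⟨ cong (A +_) (*-distribˡ-+ (suc n) (n C k) (n C suc k)) ⟨
  A + suc n * (n C k + n C suc k)
    ≡⟨ cong (λ c → A + suc n * c) (nCk+nC[k+1]≡[n+1]C[k+1] n k) ⟩
  A + suc n * A ∎
  where
  A = suc n C suc k
  B = suc n C suc (suc k)

[r+1]*[2rC[r+1]]≡r*[2rCr] : ∀ r → suc r * ((r + r) C suc r) ≡ r * ((r + r) C r)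
[r+1]*[2rC[r+1]]≡r*[2rCr] zero    = refl
[r+1]*[2rC[r+1]]≡r*[2rCr] (suc s) = begin
  suc (suc s) * (suc N C suc (suc s)) ≡⟨ [k+1]*[n+1]C[k+1]≡[n+1]*nCk N (suc s) ⟩
  suc N * (N C suc s)                 ≡⟨ cong (suc N *_) symmetric ⟩
  suc N * (N C s)                     ≡⟨ [k+1]*[n+1]C[k+1]≡[n+1]*nCk N s ⟨
  suc s * (suc N C suc s)             ∎
  where
  N = s + suc s
  symmetric : N C suc s ≡ N C s
  symmetric = trans (nCk≡nC[n∸k] (m≤n+m (suc s) s)) (cong (N C_) (m+n∸n≡m s (suc s)))

ballot≡catalan : ∀ r → ballot r 0 ≡ catalan r
ballot≡catalan r = begin
  ballot r 0                     ≡⟨ m*n/n≡m (ballot r 0) (suc r) ⟨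
  (ballot r 0 * suc r) / suc r   ≡⟨ cong (_/ suc r) times-[r+1] ⟩
  ((r + r) C r) / suc r          ≡⟨ cong (λ n → ((r + n) C r) / suc r) (+-identityʳ r) ⟨
  catalan r                      ∎
  where
  X = (r + r) C r
  Y = (r + r) C suc r
  difference : ballot r 0 + Y ≡ X
  difference = subst₂ (λ n k → ballot r 0 + n C k ≡ n C r)
                      (+-identityʳ (r + r)) (trans (+-comm (r + 0) 1) (cong suc (+-identityʳ r)))
                      (ballot-reflection r 0)
  times-[r+1] : ballot r 0 * suc r ≡ X
  times-[r+1] = +-cancelʳ-≡ (r * X) _ _ (begin
    ballot r 0 * suc r + r * X   ≡⟨ cong₂ _+_ (*-comm (ballot r 0) (suc r)) (sym ([r+1]*[2rC[r+1]]≡r*[2rCr] r)) ⟩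
    suc r * ballot r 0 + suc r * Y ≡⟨ *-distribˡ-+ (suc r) (ballot r 0) Y ⟨
    suc r * (ballot r 0 + Y)     ≡⟨ cong (suc r *_) difference ⟩
    suc r * X                    ∎)

firstPassage-odd≡catalan : ∀ r → firstPassage 1 (suc (r + r)) ≡ catalan r
firstPassage-odd≡catalan r = trans (firstPassage≡ballot r 0) (ballot≡catalan r)

odd≡1+[half+half] : ∀ R → R % 2 ≡ 1 → R ≡ suc ((R ∸ 1) / 2 + (R ∸ 1) / 2)
odd≡1+[half+half] R odd = begin
  R                     ≡⟨ R≡1+h*2 ⟩
  suc (h * 2)           ≡⟨ cong suc (trans (*-comm h 2) (cong (h +_) (+-identityʳ h))) ⟩
  suc (h + h)           ≡⟨ cong (λ x → suc (x + x)) half ⟨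
  suc ((R ∸ 1) / 2 + (R ∸ 1) / 2) ∎
  where
  h = R / 2
  R≡1+h*2 : R ≡ suc (h * 2)
  R≡1+h*2 = trans (m≡m%n+[m/n]*n R 2) (cong (_+ h * 2) odd)
  half : (R ∸ 1) / 2 ≡ h
  half = trans (cong (λ x → (x ∸ 1) / 2) R≡1+h*2) (m*n/n≡m h 2)

length-filter-≟true : ∀ (f : List ℕ → Bool) ps →
  length (filter (λ p → f p Data.Bool.≟ true) ps) ≡ sum (map (𝟙 ∘ f) ps)
length-filter-≟true f []       = refl
length-filter-≟true f (p ∷ ps) with f p
... | true  = cong suc (length-filter-≟true f ps)
... | false = length-filter-≟true f ps

countSingleUseLoss≡lossTotal : ∀ n R → countSingleUseLoss (suc n) R ≡ lossTotal R false 1 (deck (suc n))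
countSingleUseLoss≡lossTotal n R = begin
  countSingleUseLoss (suc n) R
    ≡⟨ length-filter-≟true (λ p → singleUseLoss R (initial p)) (permutations (deck (suc n))) ⟩
  ∑perm (deck (suc n)) (λ p → 𝟙 (singleUseLoss R (initial p)))
    ≡⟨ ∑perm-by-first 1 (map suc (applyUpTo suc n)) _ ⟩
  ∑pick (deck (suc n)) (λ a as → ∑perm as (λ B → 𝟙 (singleUseLoss R (initial (a ∷ B)))))
    ≡⟨ ∑pick-cong (deck (suc n)) (λ {a} {as} _ →
         ∑perm-cong as (λ B → cong 𝟙 (singleUseLoss-initial R a B))) ⟩
  lossTotal R false 1 (deck (suc n)) ∎

deck-length : ∀ n → length (deck n) ≡ n
deck-length n = trans (length-map suc (upTo n)) (length-upTo n)

deck-unique : ∀ n → Unique (deck n)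
deck-unique n = map⁺ suc-injective (upTo⁺ n)

lemma5p3 : (R n : ℕ) → R % 2 ≡ 1 → R + 1 ≤ n →
    countSingleUseLoss n R * 2 ^ R ≡ catalan ((R ∸ 1) / 2) * n !
lemma5p3 R zero    _   R+1≤0 with subst (_≤ 0) (+-comm R 1) R+1≤0
... | ()
lemma5p3 R (suc n) odd R+1≤n = begin
  countSingleUseLoss (suc n) R * 2 ^ R
    ≡⟨ *-comm _ (2 ^ R) ⟩
  2 ^ R * countSingleUseLoss (suc n) R
    ≡⟨ cong (2 ^ R *_) (countSingleUseLoss≡lossTotal n R) ⟩
  2 ^ R * lossTotal R false 1 (deck (suc n))
    ≡⟨ lossTotal≡firstPassage R false 1 (deck (suc n)) (deck-unique (suc n))
         (subst₂ _≤_ (+-comm R 1) (sym (deck-length (suc n))) R+1≤n) (λ _ → s≤s z≤n) ⟩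
  length (deck (suc n)) ! * firstPassage 1 R
    ≡⟨ cong₂ (λ l f → l ! * f) (deck-length (suc n))
             (trans (cong (firstPassage 1) (odd≡1+[half+half] R odd)) (firstPassage-odd≡catalan ((R ∸ 1) / 2))) ⟩
  suc n ! * catalan ((R ∸ 1) / 2)
    ≡⟨ *-comm (suc n !) _ ⟩
  catalan ((R ∸ 1) / 2) * suc n ! ∎
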